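{- For every positive integer $j$, the CNF $\mathrm{RVIP}^j_n$ (defined in the context) has a refutation in tree-like $\mathrm{Res}(j+1)$ ($\mathrm{Res}^*(j+1)$) of size $O(n^{j+3})$.
   Context: $[n]=\{1,\dots,n\}$. For $r\ge1$, the CNF $\mathrm{RVIP}^r_n$ has variables $R^t_i$ ($t\in[r]$, $i\in[n]$), $P_{i,a}$, $S_{i,a,l,m}$ ($i,a,l,m\in[n]$) and consists of: the unit clauses $R^1_1,\dots,R^r_1$, $P_{1,1}$, $R^1_n,\dots,R^r_n$, and $\neg P_{n,a}$ for $a\in[n]$; the clauses $\bigvee_{l>i,\,m\in[n]}S_{i,a,l,m}$ for $i\in[n-1]$, $a\in[n]$; and, for $i\in[n-1]$, $a,l,m\in[n]$, the clauses $\neg S_{i,a,l,m}\vee\neg R^1_i\vee\dots\vee\neg R^r_i\vee\neg P_{i,a}\vee R^t_l$ for each $t\in[r]$, and $\neg S_{i,a,l,m}\vee\neg R^1_i\vee\dots\vee\neg R^r_i\vee\neg P_{i,a}\vee P_{l,m}$. A $d$-clause is a disjunction of conjunctions of at most $d$ literals. $\mathrm{Res}(d)$ refutes a set of $d$-clauses by deriving the empty clause using: $\wedge$-introduction (from $P\vee\bigwedge_{i\in I_1}l_i$ and $Q\vee\bigwedge_{i\in I_2}l_i$ derive $P\vee Q\vee\bigwedge_{i\in I_1\cup I_2}l_i$ if $|I_1\cup I_2|\le d$); cut (from $P\vee\bigvee_{i\in I}l_i$ and $Q\vee\bigwedge_{i\in I}\neg l_i$ derive $P\vee Q$); weakening (from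 $P$ derive $P\vee\bigwedge_{i\in I}l_i$ with $|I|\le d$, and from $P\vee\bigwedge_{i\in I_1\cup I_2}l_i$ derive $P\vee\bigwedge_{i\in I_1}l_i$). $\mathrm{Res}^*(d)$ is the tree-like version (the derivation DAG is a tree); size is the number of nodes. -}

module Defs where

open import Data.Nat using (ℕ; zero; suc; _+_; _*_; _^_; _≤_; _<_; _<?_)
open import Data.Fin using (Fin; zero; suc; toℕ; fromℕ)
open import Data.List using (List; []; _∷_; _++_; map; concatMap; allFin; length; [_])
open import Data.List.Membership.Propositional using (_∈_)
open import Data.Bool using (Bool; true; false; not; if_then_else_)
open import Data.Product using (_×_; _,_; Σ; ∃)
open import Relation.Nullary using (does)

Lit : Set → Set
Lit V = V × Bool

pos : {V : Set} → V → Lit V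
pos v = v , true

neg : {V : Set} → V → Lit V
neg v = v , false

¬ˡ : {V : Set} → Lit V → Lit V
¬ˡ (v , b) = v , not b

-- a conjunction of literals (read as a set)
Term : Set → Set
Term V = List (Lit V)

-- a disjunction of conjunctions (read as a set of sets of literals)
Clause : Set → Set
Clause V = List (Term V)

-- an ordinary clause (disjunction of literals) as a 1-clause
litClause : {V : Set} → List (Lit V) → Clause V
litClause = map [_]

_∼ᵗ_ : {V : Set} → Term V → Term V → Set
A ∼ᵗ B = ∀ l → (l ∈ A → l ∈ B) × (l ∈ B → l ∈ A)

_⊆ᵗ_ : {V : Set} → Term V → Term V → Set
A ⊆ᵗ B = ∀ l → l ∈ A → l ∈ B

_∈ᶜ_ : {V : Set} → Term V → Clause V → Set
t ∈ᶜ C = ∃ λ t' → t' ∈ C × (t' ∼ᵗ t)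

_≈ᶜ_ : {V : Set} → Clause V → Clause V → Set
C ≈ᶜ D = ∀ t → (t ∈ᶜ C → t ∈ᶜ D) × (t ∈ᶜ D → t ∈ᶜ C)

-- Each constructor is one node of the derivation tree; clauses are
-- taken up to set equality (of the disjunction and of each conjunction).

data Deriv {V : Set} (d : ℕ) (Γ : List (Clause V)) : Clause V → Set where
  axiom  : ∀ {C D} → D ∈ Γ → C ≈ᶜ D → Deriv d Γ C
  ∧-intro : ∀ {C₁ C₂ C P Q A B T} → Deriv d Γ C₁ → Deriv d Γ C₂ →
            C₁ ≈ᶜ (A ∷ P) → C₂ ≈ᶜ (B ∷ Q) →
            T ∼ᵗ (A ++ B) → length T ≤ d →
            C ≈ᶜ (T ∷ (P ++ Q)) → Deriv d Γ C
  cut    : ∀ {C₁ C₂ C P Q} (I : List (Lit V)) → Deriv d Γ C₁ → Deriv d Γ C₂ →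
           C₁ ≈ᶜ (litClause I ++ P) → C₂ ≈ᶜ (map ¬ˡ I ∷ Q) →
           C ≈ᶜ (P ++ Q) → Deriv d Γ C
  weaken₁ : ∀ {C₁ C P T} → Deriv d Γ C₁ → C₁ ≈ᶜ P → length T ≤ d →
            C ≈ᶜ (T ∷ P) → Deriv d Γ C
  weaken₂ : ∀ {C₁ C P A B} → Deriv d Γ C₁ → C₁ ≈ᶜ (A ∷ P) → B ⊆ᵗ A →
            C ≈ᶜ (B ∷ P) → Deriv d Γ C

size : {V : Set} {d : ℕ} {Γ : List (Clause V)} {C : Clause V} → Deriv d Γ C → ℕ
size (axiom _ _) = 1
size (∧-intro π₁ π₂ _ _ _ _ _) = suc (size π₁ + size π₂)
size (cut _ π₁ π₂ _ _ _) = suc (size π₁ + size π₂)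
size (weaken₁ π _ _ _) = suc (size π)
size (weaken₂ π _ _ _) = suc (size π)

Refutation : {V : Set} → ℕ → List (Clause V) → Set
Refutation d Γ = Deriv d Γ []

-- The formula RVIP^r_n.  Index i ∈ [n] is represented by Fin n
-- (i ↦ toℕ i + 1).

data Var (r n : ℕ) : Set where
  R : Fin r → Fin n → Var r n
  P : Fin n → Fin n → Var r n
  S : Fin n → Fin n → Fin n → Fin n → Var r n

when : {A : Set} → Bool → List A → List A
when b xs = if b then xs else []

-- for n = k+1; the formula for n = 0 is not defined in the paper (empty here)
RVIP : (r n : ℕ) → List (Clause (Var r n))
RVIP r zero = []
RVIP r (suc k) =
     map (λ t → litClause [ pos (R t first) ]) (allFin r)
  ++ [ litClause [ pos (P first first) ] ]
  ++ map (λ t → litClause [ pos (R t last) ]) (allFin r)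
  ++ map (λ a → litClause [ neg (P last a) ]) (allFin n)
  ++ concatMap (λ i → when (does (suc (toℕ i) <? n)) (concatMap (λ a →
        [ litClause (concatMap (λ l → when (does (toℕ i <? toℕ l))
                       (map (λ m → pos (S i a l m)) (allFin n))) (allFin n)) ])
        (allFin n))) (allFin n)
  ++ concatMap (λ i → when (does (suc (toℕ i) <? n)) (concatMap (λ a →
       concatMap (λ l → concatMap (λ m →
         let base = neg (S i a l m) ∷ map (λ t → neg (R t i)) (allFin r) ++ [ neg (P i a) ]
         in map (λ t → litClause (base ++ [ pos (R t l) ])) (allFin r)
            ++ [ litClause (base ++ [ pos (P l m) ]) ])
       (allFin n)) (allFin n)) (allFin n))) (allFin n)
  where
  n : ℕ
  n = suc k
  first : Fin n
  first = zero
  last : Fin n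
  last = fromℕ k

-- Call node (l, m) reached when R¹_l ∧ ⋯ ∧ Rʲ_l ∧ P_{l,m}, a (j+1)-term, and let
-- beyond p be the (j+1)-clause ⋁_{l ≥ p, m} (reached l m). The unit clauses give, by
-- ∧-introduction, that (1, 1) is reached, hence beyond 1. To pass from beyond p to
-- beyond (p + 1), fix m: resolving each literal S_{p,m,l,m'} of the S-clause of (p, m)
-- against the ∧-introduced implication clauses gives
-- ¬(reached p m) ∨ ⋁_{l > p, m'} (reached l m'), and a cut against beyond p removes the
-- term (reached p m). In beyond n every term is weakened to P_{n,m} and cut against
-- ¬P_{n,m}. Each of the n layer steps consists of n derivations of size O(j n²), so the
-- refutation has size O(j n⁴) ⊆ O(n^{j+3}).

module Submission where

open import Defs
open import Data.Nat using (ℕ; zero; suc; _+_; _*_; _^_; _≤_; _<_; z≤n; s≤s; _<?_; _≤?_)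
open import Data.Nat.Properties
open import Data.Nat.Tactic.RingSolver using (solve-∀)
open import Data.Bool using (Bool; true; false)
open import Data.Bool.Properties using (not-involutive)
open import Data.Fin using (Fin; zero; toℕ; fromℕ; fromℕ<)
open import Data.Fin.Properties using (toℕ-injective; toℕ-fromℕ<; toℕ-fromℕ; toℕ<n)
open import Data.List using (List; []; _∷_; _++_; map; concatMap; allFin; length; [_])
open import Data.List.Properties using (map-++; ++-identityʳ; length-++; length-map; map-∘; length-tabulate)
open import Data.List.Membership.Propositional using (_∈_; lose; find)
open import Data.List.Membership.Propositional.Properties
  using (∈-++⁻; ∈-++⁺ˡ; ∈-++⁺ʳ; ∈-map⁻; ∈-map⁺; ∈-allFin; ∈-concatMap⁺; ∈-concatMap⁻)
open import Data.List.Relation.Unary.Any using (here; there)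
open import Data.List.Relation.Binary.Subset.Propositional using (_⊆_)
open import Data.List.Relation.Binary.Subset.Propositional.Properties
  using (⊆-refl; xs⊆xs++ys; xs⊆ys++xs; ∷⁺ʳ)
open import Data.List.Relation.Binary.Permutation.Propositional using (_↭_; ↭-sym)
open import Data.List.Relation.Binary.Permutation.Propositional.Properties using (∈-resp-↭; shift; ∷↭∷ʳ)
open import Data.Product using (Σ; ∃; _×_; _,_; proj₁; proj₂)
open import Data.Sum using (inj₁; inj₂)
open import Function using (id)
open import Relation.Binary.PropositionalEquality using (_≡_; refl; sym; trans; cong; subst)
open import Relation.Nullary using (Dec; yes; no; does; contradiction)

module _ {A : Set} where

  ++-⊆ : {xs ys zs : List A} → xs ⊆ zs → ys ⊆ zs → xs ++ ys ⊆ zs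
  ++-⊆ {xs} xs⊆zs ys⊆zs x∈ with ∈-++⁻ xs x∈
  ... | inj₁ x∈xs = xs⊆zs x∈xs
  ... | inj₂ x∈ys = ys⊆zs x∈ys

  length-concatMap≤ : {B : Set} (f : B → List A) (b : ℕ) → (∀ x → length (f x) ≤ b) →
                      (xs : List B) → length (concatMap f xs) ≤ length xs * b
  length-concatMap≤ f b short [] = z≤n
  length-concatMap≤ f b short (x ∷ xs) =
    ≤-trans (≤-reflexive (length-++ (f x))) (+-mono-≤ (short x) (length-concatMap≤ f b short xs))

  ∈-when⁺ : {P : Set} (p? : Dec P) → P → {y : A} {xs : List A} → y ∈ xs → y ∈ when (does p?) xs
  ∈-when⁺ (yes _) _ y∈ = y∈
  ∈-when⁺ (no ¬p) p _  = contradiction p ¬p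

  ∈-when⁻ : {P : Set} (p? : Dec P) {y : A} {xs : List A} → y ∈ when (does p?) xs → P × y ∈ xs
  ∈-when⁻ (yes p) y∈ = p , y∈

  length-when≤ : (b : Bool) (xs : List A) → length (when b xs) ≤ length xs
  length-when≤ true  xs = ≤-refl
  length-when≤ false xs = z≤n

length-allFin : (n : ℕ) → length (allFin n) ≡ n
length-allFin n = length-tabulate id

module _ {A : Set} {n : ℕ} (f : Fin n → List A) where

  ∈-concatMap-allFin⁺ : (i : Fin n) {y : A} → y ∈ f i → y ∈ concatMap f (allFin n)
  ∈-concatMap-allFin⁺ i y∈ = ∈-concatMap⁺ f (lose (∈-allFin i) y∈)

  ∈-concatMap-allFin⁻ : {y : A} → y ∈ concatMap f (allFin n) → ∃ λ i → y ∈ f i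
  ∈-concatMap-allFin⁻ y∈ = let (i , _ , y∈fi) = find (∈-concatMap⁻ f {xs = allFin n} y∈) in i , y∈fi

  length-concatMap-allFin≤ : (b : ℕ) → (∀ i → length (f i) ≤ b) → length (concatMap f (allFin n)) ≤ n * b
  length-concatMap-allFin≤ b short =
    ≤-trans (length-concatMap≤ f b short (allFin n)) (≤-reflexive (cong (_* b) (length-allFin n)))

length-map-allFin : {A : Set} (n : ℕ) (f : Fin n → A) → length (map f (allFin n)) ≡ n
length-map-allFin n f = trans (length-map f (allFin n)) (length-allFin n)

module _ {V : Set} where

  ∼ᵗ-refl : {A : Term V} → A ∼ᵗ A
  ∼ᵗ-refl l = (λ x → x) , (λ x → x)

  ¬ˡ-involutive : (x : Lit V) → ¬ˡ (¬ˡ x) ≡ x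
  ¬ˡ-involutive (v , b) = cong (v ,_) (not-involutive b)

  ≈ᶜ-refl : {C : Clause V} → C ≈ᶜ C
  ≈ᶜ-refl t = (λ x → x) , (λ x → x)

  ≈ᶜ-trans : {C D E : Clause V} → C ≈ᶜ D → D ≈ᶜ E → C ≈ᶜ E
  ≈ᶜ-trans C≈D D≈E t = (λ x → proj₁ (D≈E t) (proj₁ (C≈D t) x)) , (λ x → proj₂ (C≈D t) (proj₂ (D≈E t) x))

  ⊆∧⊇⇒≈ᶜ : {C D : Clause V} → C ⊆ D → D ⊆ C → C ≈ᶜ D
  ⊆∧⊇⇒≈ᶜ C⊆D D⊆C t = (λ (u , u∈C , u∼t) → u , C⊆D u∈C , u∼t) , (λ (u , u∈D , u∼t) → u , D⊆C u∈D , u∼t)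

  ↭⇒≈ᶜ : {C D : Clause V} → C ↭ D → C ≈ᶜ D
  ↭⇒≈ᶜ C↭D = ⊆∧⊇⇒≈ᶜ (∈-resp-↭ C↭D) (∈-resp-↭ (↭-sym C↭D))

  ≡⇒≈ᶜ : {C D : Clause V} → C ≡ D → C ≈ᶜ D
  ≡⇒≈ᶜ refl = ≈ᶜ-refl

  ++-absorbˡ-≈ᶜ : {C D : Clause V} → D ⊆ C → C ≈ᶜ (D ++ C)
  ++-absorbˡ-≈ᶜ D⊆C = ⊆∧⊇⇒≈ᶜ (xs⊆ys++xs _ _) (++-⊆ D⊆C ⊆-refl)

  ++-absorbʳ-≈ᶜ : {C D : Clause V} → D ⊆ C → C ≈ᶜ (C ++ D)
  ++-absorbʳ-≈ᶜ D⊆C = ⊆∧⊇⇒≈ᶜ (xs⊆xs++ys _ _) (++-⊆ ⊆-refl D⊆C)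

  ∷-dup-≈ᶜ : {t : Term V} {C : Clause V} → (t ∷ C) ≈ᶜ (t ∷ (C ++ C))
  ∷-dup-≈ᶜ {t} {C} = ⊆∧⊇⇒≈ᶜ (∷⁺ʳ t (xs⊆xs++ys C C)) (∷⁺ʳ t (++-⊆ ⊆-refl ⊆-refl))

  snoc-≈ᶜ : {t : Term V} {C : Clause V} → (C ++ [ t ]) ≈ᶜ (t ∷ C)
  snoc-≈ᶜ {t} {C} = ↭⇒≈ᶜ (↭-sym (∷↭∷ʳ t C))

module Derivations {V : Set} (d : ℕ) (Γ : List (Clause V)) where

  Deriv≤ : Clause V → ℕ → Set
  Deriv≤ C s = Σ (Deriv d Γ C) λ π → size π ≤ s

  retarget : {C C' : Clause V} → C' ≈ᶜ C → Deriv d Γ C → Deriv d Γ C'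
  retarget e (axiom D∈Γ C≈)                  = axiom D∈Γ (≈ᶜ-trans e C≈)
  retarget e (∧-intro π₁ π₂ e₁ e₂ T∼ ∣T∣≤ C≈) = ∧-intro π₁ π₂ e₁ e₂ T∼ ∣T∣≤ (≈ᶜ-trans e C≈)
  retarget e (cut I π₁ π₂ e₁ e₂ C≈)           = cut I π₁ π₂ e₁ e₂ (≈ᶜ-trans e C≈)
  retarget e (weaken₁ π e₁ ∣T∣≤ C≈)           = weaken₁ π e₁ ∣T∣≤ (≈ᶜ-trans e C≈)
  retarget e (weaken₂ π e₁ B⊆A C≈)            = weaken₂ π e₁ B⊆A (≈ᶜ-trans e C≈)

  size-retarget : {C C' : Clause V} (e : C' ≈ᶜ C) (π : Deriv d Γ C) → size (retarget e π) ≡ size π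
  size-retarget e (axiom _ _)             = refl
  size-retarget e (∧-intro _ _ _ _ _ _ _) = refl
  size-retarget e (cut _ _ _ _ _ _)       = refl
  size-retarget e (weaken₁ _ _ _ _)       = refl
  size-retarget e (weaken₂ _ _ _ _)       = refl

  Deriv≤-resp : {C C' : Clause V} {s : ℕ} → C' ≈ᶜ C → Deriv≤ C s → Deriv≤ C' s
  Deriv≤-resp e (π , π≤) = retarget e π , subst (_≤ _) (sym (size-retarget e π)) π≤

  Deriv≤-mono : {C : Clause V} {s s' : ℕ} → s ≤ s' → Deriv≤ C s → Deriv≤ C s'
  Deriv≤-mono s≤s' (π , π≤) = π , ≤-trans π≤ s≤s'

  axiom≤ : {C : Clause V} → C ∈ Γ → Deriv≤ C 1
  axiom≤ C∈Γ = axiom C∈Γ ≈ᶜ-refl , ≤-refl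

  weaken-all : (ts : Clause V) → (∀ {t} → t ∈ ts → length t ≤ d) →
               {C : Clause V} {s : ℕ} → Deriv≤ C s → Deriv≤ (ts ++ C) (length ts + s)
  weaken-all []       _     π = π
  weaken-all (t ∷ ts) short π =
    let (ρ , ρ≤) = weaken-all ts (λ t∈ → short (there t∈)) π
    in weaken₁ ρ ≈ᶜ-refl (short (here refl)) ≈ᶜ-refl , s≤s ρ≤

  ∧-intro-all : (base : List (Lit V)) (ls : Term V) → 1 ≤ length ls → length ls ≤ d →
                (∀ {x} → x ∈ ls → litClause (base ++ [ x ]) ∈ Γ) →
                Deriv≤ (litClause base ++ [ ls ]) (length ls * 2)
  ∧-intro-all base (x ∷ []) _ _ ax =
    Deriv≤-mono (s≤s z≤n) (Deriv≤-resp (≡⇒≈ᶜ (sym (map-++ [_] base [ x ]))) (axiom≤ (ax (here refl))))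
  ∧-intro-all base (x ∷ y ∷ ys) _ ∣ls∣≤d ax =
    let (π , π≤) = ∧-intro-all base (y ∷ ys) (s≤s z≤n) (≤-trans (n≤1+n _) ∣ls∣≤d) (λ z∈ → ax (there z∈))
    in ∧-intro (axiom (ax (here refl)) ≈ᶜ-refl) π
               (≈ᶜ-trans (≡⇒≈ᶜ (map-++ [_] base [ x ])) snoc-≈ᶜ) snoc-≈ᶜ
               ∼ᵗ-refl ∣ls∣≤d (≈ᶜ-trans snoc-≈ᶜ ∷-dup-≈ᶜ)
       , s≤s (s≤s π≤)

  -- The term τ x is removed from Y ∨ ⋁ τ xs by weakening it to ⋀ ¬(I x) and cutting
  -- against ⋁ (I x) ∨ Q x; the invariant Q x ⊆ Y keeps the remaining clause inside Y.
  resolve-all : {X : Set} (τ : X → Term V) (I : X → List (Lit V)) (Q : X → Clause V)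
                {Y : Clause V} {b : ℕ} (xs : List X) →
                (∀ {x} → x ∈ xs → map ¬ˡ (I x) ⊆ᵗ τ x) →
                (∀ {x} → x ∈ xs → Q x ⊆ Y) →
                (∀ {x} → x ∈ xs → Deriv≤ (litClause (I x) ++ Q x) b) →
                {s : ℕ} → Deriv≤ (Y ++ map τ xs) s → Deriv≤ Y (length xs * (2 + b) + s)
  resolve-all τ I Q {Y} [] _ _ _ π = Deriv≤-resp (≡⇒≈ᶜ (sym (++-identityʳ Y))) π
  resolve-all τ I Q {Y} {b} (x ∷ xs) ¬I⊆τ Q⊆Y side {s} (π , π≤) =
    Deriv≤-mono (≤-reflexive (reassociate (length xs) b s))
      (resolve-all τ I Q xs (λ x∈ → ¬I⊆τ (there x∈)) (λ x∈ → Q⊆Y (there x∈)) (λ x∈ → side (there x∈))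
        ( cut (I x) (proj₁ (side (here refl)))
              (weaken₂ π (↭⇒≈ᶜ (shift (τ x) Y (map τ xs))) (¬I⊆τ (here refl)) ≈ᶜ-refl)
              ≈ᶜ-refl ≈ᶜ-refl (++-absorbˡ-≈ᶜ (λ q∈ → ∈-++⁺ˡ (Q⊆Y (here refl) q∈)))
        , s≤s (+-mono-≤ (proj₂ (side (here refl))) (s≤s π≤))))
    where
    reassociate : ∀ l b s → l * (2 + b) + suc (b + suc s) ≡ suc l * (2 + b) + s
    reassociate = solve-∀

module RVIPRefutation (j k : ℕ) where

  n : ℕ
  n = suc k

  V : Set
  V = Var j n

  Γ : List (Clause V)
  Γ = RVIP j n

  open Derivations (j + 1) Γ

  reached : Fin n → Fin n → Term V
  reached l m = map (λ t → pos (R t l)) (allFin j) ++ [ pos (P l m) ]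

  unreached : Fin n → Fin n → List (Lit V)
  unreached i a = map (λ t → neg (R t i)) (allFin j) ++ [ neg (P i a) ]

  successors-to : Fin n → Fin n → Fin n → List (Lit V)
  successors-to i a l = when (does (toℕ i <? toℕ l)) (map (λ m → pos (S i a l m)) (allFin n))

  successors : Fin n → Fin n → List (Lit V)
  successors i a = concatMap (successors-to i a) (allFin n)

  -- Only ever applied to the literals of successors i a.
  implied : Lit V → Term V
  implied (S _ _ l m , _) = reached l m
  implied _               = []

  beyond-layer : ℕ → Fin n → Clause V
  beyond-layer p l = when (does (p ≤? toℕ l)) (map (reached l) (allFin n))

  beyond : ℕ → Clause V
  beyond p = concatMap (beyond-layer p) (allFin n)

  -- Γ unfolds to R-first-clauses ++ [ P₁₁ ] ++ R-last-clauses ++ ¬P-last-clauses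
  --             ++ below-last successor-layer ++ below-last implication-layer.
  R-first-clauses R-last-clauses : List (Clause V)
  R-first-clauses = map (λ t → litClause [ pos (R t zero) ]) (allFin j)
  R-last-clauses  = map (λ t → litClause [ pos (R t (fromℕ k)) ]) (allFin j)

  ¬P-last-clauses : List (Clause V)
  ¬P-last-clauses = map (λ a → litClause [ neg (P (fromℕ k) a) ]) (allFin n)

  implication : Fin n → Fin n → Fin n → Fin n → Lit V → Clause V
  implication i a l m x = litClause ((neg (S i a l m) ∷ unreached i a) ++ [ x ])

  implications : Fin n → Fin n → Fin n → Fin n → List (Clause V)
  implications i a l m =
    map (λ t → implication i a l m (pos (R t l))) (allFin j) ++ [ implication i a l m (pos (P l m)) ]

  successor-layer implication-layer : Fin n → List (Clause V)
  successor-layer i   = concatMap (λ a → [ litClause (successors i a) ]) (allFin n)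
  implication-layer i =
    concatMap (λ a → concatMap (λ l → concatMap (implications i a l) (allFin n)) (allFin n)) (allFin n)

  below-last : (Fin n → List (Clause V)) → List (Clause V)
  below-last layer = concatMap (λ i → when (does (suc (toℕ i) <? n)) (layer i)) (allFin n)

  ∈-below-last : (layer : Fin n → List (Clause V)) {i : Fin n} → suc (toℕ i) < n →
                 {C : Clause V} → C ∈ layer i → C ∈ below-last layer
  ∈-below-last layer {i} i<last C∈ =
    ∈-concatMap-allFin⁺ (λ i → when (does (suc (toℕ i) <? n)) (layer i)) i
      (∈-when⁺ (suc (toℕ i) <? n) i<last C∈)

  ∈-Γ-tail : {C : Clause V} →
             C ∈ ¬P-last-clauses ++ below-last successor-layer ++ below-last implication-layer → C ∈ Γ
  ∈-Γ-tail C∈ = ∈-++⁺ʳ R-first-clauses (there (∈-++⁺ʳ R-last-clauses C∈))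

  R-first∈Γ : (t : Fin j) → litClause [ pos (R t zero) ] ∈ Γ
  R-first∈Γ t = ∈-++⁺ˡ (∈-map⁺ _ (∈-allFin t))

  P-first∈Γ : litClause [ pos (P zero zero) ] ∈ Γ
  P-first∈Γ = ∈-++⁺ʳ R-first-clauses (here refl)

  ¬P-last∈Γ : (a : Fin n) → litClause [ neg (P (fromℕ k) a) ] ∈ Γ
  ¬P-last∈Γ a = ∈-Γ-tail (∈-++⁺ˡ (∈-map⁺ _ (∈-allFin a)))

  successors∈Γ : (i a : Fin n) → suc (toℕ i) < n → litClause (successors i a) ∈ Γ
  successors∈Γ i a i<last = ∈-Γ-tail (∈-++⁺ʳ ¬P-last-clauses (∈-++⁺ˡ
    (∈-below-last successor-layer i<last
      (∈-concatMap-allFin⁺ (λ a → [ litClause (successors i a) ]) a (here refl)))))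

  implication∈Γ : (i a l m : Fin n) → suc (toℕ i) < n → ∀ {x} → x ∈ reached l m → implication i a l m x ∈ Γ
  implication∈Γ i a l m i<last x∈ = ∈-Γ-tail (∈-++⁺ʳ ¬P-last-clauses (∈-++⁺ʳ (below-last successor-layer)
    (∈-below-last implication-layer i<last
      (∈-concatMap-allFin⁺ (λ a → concatMap (λ l → concatMap (implications i a l) (allFin n)) (allFin n)) a
        (∈-concatMap-allFin⁺ (λ l → concatMap (implications i a l) (allFin n)) l
          (∈-concatMap-allFin⁺ (implications i a l) m (for-literal x∈)))))))
    where
    for-literal : ∀ {x} → x ∈ reached l m → implication i a l m x ∈ implications i a l m
    for-literal x∈ with ∈-++⁻ (map (λ t → pos (R t l)) (allFin j)) x∈
    ... | inj₁ x∈R with ∈-map⁻ _ x∈R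
    ...   | t , _ , refl = ∈-++⁺ˡ (∈-map⁺ _ (∈-allFin t))
    for-literal x∈ | inj₂ (here refl) = ∈-++⁺ʳ _ (here refl)

  ∈-successors⁻ : {i a : Fin n} {s : Lit V} → s ∈ successors i a →
                  ∃ λ l → ∃ λ m → toℕ i < toℕ l × s ≡ pos (S i a l m)
  ∈-successors⁻ {i} {a} s∈ =
    let (l , s∈l) = ∈-concatMap-allFin⁻ (successors-to i a) s∈
        (i<l , s∈m) = ∈-when⁻ (toℕ i <? toℕ l) s∈l
        (m , _ , s≡) = ∈-map⁻ _ s∈m
    in l , m , i<l , s≡

  ∈-beyond⁺ : (p : ℕ) (l m : Fin n) → p ≤ toℕ l → reached l m ∈ beyond p
  ∈-beyond⁺ p l m p≤l =
    ∈-concatMap-allFin⁺ (beyond-layer p) l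
      (∈-when⁺ (p ≤? toℕ l) p≤l (∈-map⁺ _ (∈-allFin m)))

  ∈-beyond⁻ : (p : ℕ) {t : Term V} → t ∈ beyond p → ∃ λ l → ∃ λ m → p ≤ toℕ l × t ≡ reached l m
  ∈-beyond⁻ p t∈ =
    let (l , t∈l) = ∈-concatMap-allFin⁻ (beyond-layer p) t∈
        (p≤l , t∈m) = ∈-when⁻ (p ≤? toℕ l) t∈l
        (m , _ , t≡) = ∈-map⁻ _ t∈m
    in l , m , p≤l , t≡

  length-reached : (l m : Fin n) → length (reached l m) ≡ j + 1
  length-reached l m =
    trans (length-++ (map (λ t → pos (R t l)) (allFin j))) (cong (_+ 1) (length-map-allFin j _))

  length-unreached : (i a : Fin n) → length (litClause (unreached i a)) ≡ j + 1
  length-unreached i a = trans (length-map [_] (unreached i a))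
    (trans (length-++ (map (λ t → neg (R t i)) (allFin j))) (cong (_+ 1) (length-map-allFin j _)))

  length-successors : (i a : Fin n) → length (successors i a) ≤ n * n
  length-successors i a = length-concatMap-allFin≤ (successors-to i a) n
    (λ l → ≤-trans (length-when≤ (does (toℕ i <? toℕ l)) _)
                   (≤-reflexive (length-map-allFin n (λ m → pos (S i a l m)))))

  length-beyond : (p : ℕ) → length (beyond p) ≤ n * n
  length-beyond p = length-concatMap-allFin≤ (beyond-layer p) n
    (λ l → ≤-trans (length-when≤ (does (p ≤? toℕ l)) _) (≤-reflexive (length-map-allFin n (reached l))))

  width-beyond : (p : ℕ) {t : Term V} → t ∈ beyond p → length t ≤ j + 1
  width-beyond p t∈ with ∈-beyond⁻ p t∈
  ... | l , m , _ , refl = ≤-reflexive (length-reached l m)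

  map-¬ˡ-unreached : (i a : Fin n) → map ¬ˡ (unreached i a) ≡ reached i a
  map-¬ˡ-unreached i a = trans (map-++ ¬ˡ (map (λ t → neg (R t i)) (allFin j)) [ neg (P i a) ])
                               (cong (_++ [ pos (P i a) ]) (sym (map-∘ (allFin j))))

  beyond-split : (i : Fin n) → (beyond (suc (toℕ i)) ++ map (reached i) (allFin n)) ≈ᶜ beyond (toℕ i)
  beyond-split i = ⊆∧⊇⇒≈ᶜ (++-⊆ later current) split
    where
    later : beyond (suc (toℕ i)) ⊆ beyond (toℕ i)
    later t∈ with ∈-beyond⁻ (suc (toℕ i)) t∈
    ... | l , m , i<l , refl = ∈-beyond⁺ (toℕ i) l m (<⇒≤ i<l)
    current : map (reached i) (allFin n) ⊆ beyond (toℕ i)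
    current t∈ with ∈-map⁻ _ t∈
    ... | m , _ , refl = ∈-beyond⁺ (toℕ i) i m ≤-refl
    split : beyond (toℕ i) ⊆ beyond (suc (toℕ i)) ++ map (reached i) (allFin n)
    split t∈ with ∈-beyond⁻ (toℕ i) t∈
    ... | l , m , i≤l , refl with m≤n⇒m<n∨m≡n i≤l
    ...   | inj₁ i<l = ∈-++⁺ˡ (∈-beyond⁺ (suc (toℕ i)) l m i<l)
    ...   | inj₂ i≡l rewrite toℕ-injective i≡l = ∈-++⁺ʳ _ (∈-map⁺ _ (∈-allFin m))

  beyond-last : map (reached (fromℕ k)) (allFin n) ≈ᶜ beyond k
  beyond-last = ⊆∧⊇⇒≈ᶜ last⊆ ⊆last
    where
    last⊆ : map (reached (fromℕ k)) (allFin n) ⊆ beyond k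
    last⊆ t∈ with ∈-map⁻ _ t∈
    ... | m , _ , refl = ∈-beyond⁺ k (fromℕ k) m (≤-reflexive (sym (toℕ-fromℕ k)))
    ⊆last : beyond k ⊆ map (reached (fromℕ k)) (allFin n)
    ⊆last t∈ with ∈-beyond⁻ k t∈
    ... | l , m , k≤l , refl
      with toℕ-injective {i = l} {j = fromℕ k} (trans (≤-antisym (≤-pred (toℕ<n l)) k≤l) (sym (toℕ-fromℕ k)))
    ...   | refl = ∈-map⁺ _ (∈-allFin m)

  reached-from : (base : List (Lit V)) (l m : Fin n) →
                 (∀ {x} → x ∈ reached l m → litClause (base ++ [ x ]) ∈ Γ) →
                 Deriv≤ (litClause base ++ [ reached l m ]) ((j + 1) * 2)
  reached-from base l m ax =
    Deriv≤-mono (≤-reflexive (cong (_* 2) (length-reached l m)))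
      (∧-intro-all base (reached l m) (subst (1 ≤_) (sym (length-reached l m)) (m≤n+m 1 j))
                   (≤-reflexive (length-reached l m)) ax)

  start-cost : ℕ
  start-cost = n * n + (j + 1) * 2

  beyond-zero : Deriv≤ (beyond 0) start-cost
  beyond-zero = Deriv≤-mono (+-monoˡ-≤ _ (length-beyond 0))
    (Deriv≤-resp (++-absorbʳ-≈ᶜ (λ { (here refl) → ∈-beyond⁺ 0 zero zero z≤n }))
      (weaken-all (beyond 0) (width-beyond 0) (reached-from [] zero zero unit)))
    where
    unit : ∀ {x} → x ∈ reached zero zero → litClause [ x ] ∈ Γ
    unit x∈ with ∈-++⁻ (map (λ t → pos (R t zero)) (allFin j)) x∈
    ... | inj₁ x∈R with ∈-map⁻ _ x∈R
    ...   | t , _ , refl = R-first∈Γ t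
    unit x∈ | inj₂ (here refl) = P-first∈Γ

  advance-cost : ℕ
  advance-cost = n * n * (2 + (j + 1) * 2) + ((j + 1) + n * n + 1)

  -- From the S-clause of (i, a), each literal S_{i,a,l,m} is traded for (reached l m).
  advance : (i a : Fin n) → suc (toℕ i) < n →
            Deriv≤ (litClause (unreached i a) ++ map implied (successors i a)) advance-cost
  advance i a i<last =
    Deriv≤-mono (+-mono-≤ (*-monoˡ-≤ _ (length-successors i a)) (+-monoˡ-≤ 1 length-Y))
      (resolve-all [_] (λ s → [ ¬ˡ s ]) (λ s → litClause (unreached i a) ++ [ implied s ]) (successors i a)
         ¬¬s⊆s implied⊆Y side (weaken-all Y width (axiom≤ (successors∈Γ i a i<last))))
    where
    Y : Clause V
    Y = litClause (unreached i a) ++ map implied (successors i a)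
    ¬¬s⊆s : ∀ {s} → s ∈ successors i a → map ¬ˡ [ ¬ˡ s ] ⊆ᵗ [ s ]
    ¬¬s⊆s {s} _ _ (here refl) = here (¬ˡ-involutive s)
    implied⊆Y : ∀ {s} → s ∈ successors i a → litClause (unreached i a) ++ [ implied s ] ⊆ Y
    implied⊆Y s∈ = ++-⊆ (xs⊆xs++ys _ (map implied (successors i a)))
                        (λ { (here refl) → ∈-++⁺ʳ (litClause (unreached i a)) (∈-map⁺ implied s∈) })
    side : ∀ {s} → s ∈ successors i a →
           Deriv≤ ([ ¬ˡ s ] ∷ litClause (unreached i a) ++ [ implied s ]) ((j + 1) * 2)
    side s∈ with ∈-successors⁻ s∈
    ... | l , m , _ , refl = reached-from (neg (S i a l m) ∷ unreached i a) l m (implication∈Γ i a l m i<last)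
    width : ∀ {t} → t ∈ Y → length t ≤ j + 1
    width t∈ with ∈-++⁻ (litClause (unreached i a)) t∈
    ... | inj₁ t∈U with ∈-map⁻ [_] t∈U
    ...   | _ , _ , refl = m≤n+m 1 j
    width t∈ | inj₂ t∈I with ∈-map⁻ implied t∈I
    ...   | s , s∈ , refl with ∈-successors⁻ s∈
    ...     | l , m , _ , refl = ≤-reflexive (length-reached l m)
    length-Y : length Y ≤ (j + 1) + n * n
    length-Y = ≤-trans (≤-reflexive (length-++ (litClause (unreached i a))))
      (+-mono-≤ (≤-reflexive (length-unreached i a))
                (≤-trans (≤-reflexive (length-map implied (successors i a))) (length-successors i a)))

  layer-cost : ℕ
  layer-cost = n * (2 + advance-cost)

  beyond-step : (i : Fin n) {p : ℕ} → toℕ i ≡ p → p < k → {s : ℕ} →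
                Deriv≤ (beyond p) s → Deriv≤ (beyond (suc p)) (layer-cost + s)
  beyond-step i refl i<k {s} π =
    Deriv≤-mono (≤-reflexive (cong (λ z → z * (2 + advance-cost) + s) (length-allFin n)))
      (resolve-all (reached i) (unreached i) (λ a → map implied (successors i a)) (allFin n)
        (λ {a} _ _ l∈ → subst (_ ∈_) (map-¬ˡ-unreached i a) l∈)
        implied⊆beyond
        (λ {a} _ → advance i a (s≤s i<k))
        (Deriv≤-resp (beyond-split i) π))
    where
    implied⊆beyond : ∀ {a} → a ∈ allFin n → map implied (successors i a) ⊆ beyond (suc (toℕ i))
    implied⊆beyond _ t∈ with ∈-map⁻ implied t∈
    ... | s , s∈ , refl with ∈-successors⁻ s∈
    ...   | l , m , i<l , refl = ∈-beyond⁺ (suc (toℕ i)) l m i<l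

  beyond-reach : (p : ℕ) → p ≤ k → Deriv≤ (beyond p) (p * layer-cost + start-cost)
  beyond-reach zero    _     = beyond-zero
  beyond-reach (suc p) 1+p≤k =
    Deriv≤-mono (≤-reflexive (sym (+-assoc layer-cost _ _)))
      (beyond-step (fromℕ< p<n) (toℕ-fromℕ< p<n) 1+p≤k (beyond-reach p (<⇒≤ 1+p≤k)))
    where
    p<n : p < n
    p<n = s≤s (<⇒≤ 1+p≤k)

  refutation-cost : ℕ
  refutation-cost = n * 3 + (k * layer-cost + start-cost)

  refutation : Deriv≤ [] refutation-cost
  refutation =
    Deriv≤-mono (≤-reflexive (cong (λ z → z * 3 + (k * layer-cost + start-cost)) (length-allFin n)))
      (resolve-all (reached (fromℕ k)) (λ a → [ neg (P (fromℕ k) a) ]) (λ _ → []) {Y = []} (allFin n)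
        (λ _ → λ { _ (here refl) → ∈-++⁺ʳ _ (here refl) })
        (λ _ ())
        (λ {a} _ → axiom≤ (¬P-last∈Γ a))
        (Deriv≤-resp beyond-last (beyond-reach k ≤-refl)))

quartic-bound : (a b c e k : ℕ) → let n = suc k in
                a * (n * n * (n * n)) + b * (n * n) + c * n + e ≤ (a + b + c + e) * (n * n * (n * n))
quartic-bound a b c e k = begin
    a * N + b * (n * n) + c * n + e
  ≤⟨ +-mono-≤ (+-mono-≤ (+-monoʳ-≤ (a * N) (*-monoʳ-≤ b n²≤N)) (*-monoʳ-≤ c (≤-trans (m≤m*n n n) n²≤N)))
              (m≤m*n e N) ⟩
    a * N + b * N + c * N + e * N
  ≡⟨ distribute a b c e N ⟩
    (a + b + c + e) * N ∎
  where
  open ≤-Reasoning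
  n = suc k
  N = n * n * (n * n)
  n²≤N : n * n ≤ N
  n²≤N = m≤m*n (n * n) (n * n)
  distribute : ∀ a b c e x → a * x + b * x + c * x + e * x ≡ (a + b + c + e) * x
  distribute = solve-∀

n⁴≤n^[j+3] : (j k : ℕ) → 1 ≤ j → let n = suc k in n * n * (n * n) ≤ n ^ (j + 3)
n⁴≤n^[j+3] j k 1≤j = begin
    n * n * (n * n)        ≡⟨ *-assoc n n (n * n) ⟩
    n * (n * (n * n))      ≡⟨ cong (λ x → n * (n * (n * x))) (sym (*-identityʳ n)) ⟩
    n ^ 4                  ≤⟨ ^-monoʳ-≤ n (+-monoˡ-≤ 3 1≤j) ⟩
    n ^ (j + 3) ∎
  where
  open ≤-Reasoning
  n = suc k

refutation-cost≤ : (j k : ℕ) → 1 ≤ j → RVIPRefutation.refutation-cost j k ≤ (5 * j + 15) * suc k ^ (j + 3)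
refutation-cost≤ j k 1≤j = begin
    n * 3 + (k * layer-cost + start-cost)
  ≤⟨ +-monoʳ-≤ (n * 3) (+-monoˡ-≤ start-cost (*-monoˡ-≤ layer-cost (n≤1+n k))) ⟩
    n * 3 + (n * layer-cost + start-cost)
  ≡⟨ expand j n ⟩
    (2 * j + 5) * N + (j + 5) * (n * n) + 3 * n + (2 * j + 2)
  ≤⟨ quartic-bound (2 * j + 5) (j + 5) 3 (2 * j + 2) k ⟩
    ((2 * j + 5) + (j + 5) + 3 + (2 * j + 2)) * N
  ≡⟨ cong (_* N) (sum-coefficients j) ⟩
    (5 * j + 15) * N
  ≤⟨ *-monoʳ-≤ (5 * j + 15) (n⁴≤n^[j+3] j k 1≤j) ⟩
    (5 * j + 15) * n ^ (j + 3) ∎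
  where
  open ≤-Reasoning
  open RVIPRefutation j k using (n; layer-cost; start-cost)
  N = n * n * (n * n)
  expand : ∀ j n →
           n * 3 + (n * (n * (2 + (n * n * (2 + (j + 1) * 2) + ((j + 1) + n * n + 1)))) + (n * n + (j + 1) * 2))
                   ≡ (2 * j + 5) * (n * n * (n * n)) + (j + 5) * (n * n) + 3 * n + (2 * j + 2)
  expand = solve-∀
  sum-coefficients : ∀ j → (2 * j + 5) + (j + 5) + 3 + (2 * j + 2) ≡ 5 * j + 15
  sum-coefficients = solve-∀

mainTheorem3 : (j : ℕ) → 1 ≤ j →
    ∃ λ (c : ℕ) → ∃ λ (n₀ : ℕ) → (n : ℕ) → n₀ ≤ n → 1 ≤ n →
      Σ (Refutation (j + 1) (RVIP j n)) (λ π → size π ≤ c * n ^ (j + 3))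
mainTheorem3 j 1≤j = 5 * j + 15 , 1 , refute
  where
  refute : (n : ℕ) → 1 ≤ n → 1 ≤ n →
           Σ (Refutation (j + 1) (RVIP j n)) (λ π → size π ≤ (5 * j + 15) * n ^ (j + 3))
  refute (suc k) _ _ =
    let (π , π≤) = RVIPRefutation.refutation j k in π , ≤-trans π≤ (refutation-cost≤ j k 1≤j)
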